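{- Let $\bar a$ be an independent tuple and $b$ an element of a Steiner quasigroup $M$. If there are reduced terms $t(\bar x,y)$ and $r(\bar x,y)$ such that $t(\bar a,b)=r(\bar a,b)$ and $t\not\sim r$, then there is a reduced term $t'(\bar x,y)$ such that $t'(\bar a,b)\in\langle\bar a\rangle$ and the variable $y$ appears in $t'$.
   Context: A Steiner quasigroup is a set with a binary operation $\cdot$ satisfying $x\cdot y=y\cdot x$, $x\cdot x=x$, $x\cdot(x\cdot y)=y$. A tuple is independent if its entries are pairwise distinct and the substructure $\langle\bar a\rangle$ they generate is freely generated by them. Terms are built from variables by the binary product. $t_1\sim t_2$ means $t_2$ is obtained from $t_1$ by zero or more applications of commutativity to subterms. A term is reduced if it has no subterm of the form $t_1t_2$ with $t_1\sim t_2$, nor $t_1(t_2t_3)$ with $t_1\sim t_2$ or $t_1\sim t_3$, nor $(t_1t_2)t_3$ with $t_1\sim t_3$ or $t_2\sim t_3$. -}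

module Defs where

open import Data.Nat using (ℕ)
open import Data.Fin using (Fin)
open import Data.Unit using (⊤; tt)
open import Data.Sum using (_⊎_; inj₁; inj₂; [_,_])
open import Data.Product using (Σ; ∃; _×_; _,_)
open import Relation.Nullary using (¬_)
open import Relation.Binary.PropositionalEquality using (_≡_)
open import Relation.Binary.Construct.Closure.ReflexiveTransitive using (Star)
open import Function.Definitions using (Injective)

record SteinerQuasigroup : Set₁ where
  infixl 7 _·_
  field
    Carrier : Set
    _·_     : Carrier → Carrier → Carrier
    comm    : ∀ x y → x · y ≡ y · x
    idem    : ∀ x → x · x ≡ x
    absorb  : ∀ x y → x · (x · y) ≡ y

infixl 7 _∙_
data Term (V : Set) : Set where
  var : V → Term V
  _∙_ : Term V → Term V → Term V

eval : (M : SteinerQuasigroup) {V : Set} → (V → SteinerQuasigroup.Carrier M) →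
       Term V → SteinerQuasigroup.Carrier M
eval M ρ (var v) = ρ v
eval M ρ (t ∙ s) = SteinerQuasigroup._·_ M (eval M ρ t) (eval M ρ s)

data CommStep {V : Set} : Term V → Term V → Set where
  here  : ∀ t s → CommStep (t ∙ s) (s ∙ t)
  left  : ∀ {t t'} s → CommStep t t' → CommStep (t ∙ s) (t' ∙ s)
  right : ∀ t {s s'} → CommStep s s' → CommStep (t ∙ s) (t ∙ s')

infix 4 _∼_
_∼_ : {V : Set} → Term V → Term V → Set
_∼_ = Star CommStep

RightOK : {V : Set} → Term V → Term V → Set
RightOK t (var _)   = ⊤
RightOK t (s₁ ∙ s₂) = ¬ (t ∼ s₁) × ¬ (t ∼ s₂)

LeftOK : {V : Set} → Term V → Term V → Set
LeftOK (var _)   s = ⊤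
LeftOK (t₁ ∙ t₂) s = ¬ (t₁ ∼ s) × ¬ (t₂ ∼ s)

Reduced : {V : Set} → Term V → Set
Reduced (var _) = ⊤
Reduced (t ∙ s) = Reduced t × Reduced s × ¬ (t ∼ s) × RightOK t s × LeftOK t s

data Occurs {V : Set} (v : V) : Term V → Set where
  here  : Occurs v (var v)
  left  : ∀ {t} s → Occurs v t → Occurs v (t ∙ s)
  right : ∀ t {s} → Occurs v s → Occurs v (t ∙ s)

-- Variables x̄ = (x_i)_{i<n} together with one extra variable y
Var : ℕ → Set
Var n = Fin n ⊎ ⊤

yvar : {n : ℕ} → Var n
yvar = inj₂ tt

_,,_ : {A : Set} {n : ℕ} → (Fin n → A) → A → Var n → A
(a ,, b) = [ a , (λ _ → b) ]

module _ (M : SteinerQuasigroup) where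
  open SteinerQuasigroup M

  InGen : {n : ℕ} → (Fin n → Carrier) → Carrier → Set
  InGen a c = ∃ λ (s : Term (Fin _)) → eval M a s ≡ c

  -- ⟨ā⟩ is freely generated by ā: every map from the generators to a
  -- Steiner quasigroup N extends to a homomorphism ⟨ā⟩ → N.
  -- (A map on ⟨ā⟩ is a function on elements of M together with a
  -- membership proof, required to be independent of that proof.)
  FreelyGenerated : {n : ℕ} → (Fin n → Carrier) → Set₁
  FreelyGenerated {n} a =
    (N : SteinerQuasigroup) (f : Fin n → SteinerQuasigroup.Carrier N) →
    Σ ((c : Carrier) → InGen a c → SteinerQuasigroup.Carrier N) λ h →
      (∀ c p q → h c p ≡ h c q) ×
      (∀ i → (p : InGen a (a i)) → h (a i) p ≡ f i) ×
      (∀ c d (p : InGen a c) (q : InGen a d) (r : InGen a (c · d)) →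
         h (c · d) r ≡ SteinerQuasigroup._·_ N (h c p) (h d q))

  Independent : {n : ℕ} → (Fin n → Carrier) → Set₁
  Independent a = Injective _≡_ _≡_ a × FreelyGenerated a

{-# OPTIONS --safe #-}
-- Fix a total order on terms. Reduced terms all of whose products list the
-- smaller factor first ("canonical" terms) form a free Steiner quasigroup on
-- the variables, and every reduced term is ∼-equivalent to exactly one of
-- them. Let p ≠ q be the canonical forms of t and r, and put w = p·x₀ and
-- q' = w·q in that free quasigroup. Then q' evaluates to (p·a₀)·p = a₀, and
-- q' ≠ x₀ since w·p = x₀ and left multiplication is injective. Freeness of
-- ⟨ā⟩ makes evaluation injective on canonical terms without y, so y must
-- occur in q'. Without x-variables the only reduced term is y itself.
module Submission where

open import Defs
open import Level using (0ℓ)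
open import Data.Nat as ℕ using (ℕ; zero; suc)
open import Data.Nat.Properties using (<-cmp; suc-injective)
open import Data.Fin as Fin using (Fin; toℕ)
open import Data.Fin.Properties using (toℕ-injective)
open import Data.Unit using (⊤; tt)
open import Data.Empty using (⊥-elim)
open import Data.Sum using (inj₁; inj₂; [_,_])
open import Data.Product using (Σ; _×_; _,_; proj₁)
open import Data.Bool.Properties using (T-irrelevant)
open import Function using (_∘_; _on_)
open import Relation.Nullary using (¬_; Dec; yes; no)
open import Relation.Nullary.Decidable
  using (True; toWitness; fromWitness; map′; ¬?; _×-dec_; _⊎-dec_; decidable-stable)
open import Relation.Binary.Core using (Rel)
open import Relation.Binary.Definitions using (Trichotomous; tri<; tri≈; tri>; DecidableEquality)
open import Relation.Binary.Consequences using (tri⇒dec≈; tri⇒dec<; tri⇒irr)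
open import Relation.Binary.PropositionalEquality
  using (_≡_; _≢_; refl; sym; trans; cong; cong₂; subst; module ≡-Reasoning)
open import Relation.Binary.Construct.Closure.ReflexiveTransitive
  using (ε; _◅_; _◅◅_; gmap; reverse)

module SteinerQuasigroupProperties (M : SteinerQuasigroup) where
  open SteinerQuasigroup M
  open ≡-Reasoning

  x·[y·x]≡y : ∀ x y → x · (y · x) ≡ y
  x·[y·x]≡y x y = trans (cong (x ·_) (comm y x)) (absorb x y)

  [x·y]·x≡y : ∀ x y → (x · y) · x ≡ y
  [x·y]·x≡y x y = trans (comm (x · y) x) (absorb x y)

  [y·x]·x≡y : ∀ x y → (y · x) · x ≡ y
  [y·x]·x≡y x y = trans (comm (y · x) x) (x·[y·x]≡y x y)

  ·-cancelˡ : ∀ x {y z} → x · y ≡ x · z → y ≡ z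
  ·-cancelˡ x {y} {z} eq = begin
    y            ≡⟨ sym (absorb x y) ⟩
    x · (x · y)  ≡⟨ cong (x ·_) eq ⟩
    x · (x · z)  ≡⟨ absorb x z ⟩
    z            ∎

module _ {V : Set} where

  commStep-sym : {t s : Term V} → CommStep t s → CommStep s t
  commStep-sym (here t s)   = here s t
  commStep-sym (left s st)  = left s (commStep-sym st)
  commStep-sym (right t st) = right t (commStep-sym st)

  ∼-sym : {t s : Term V} → t ∼ s → s ∼ t
  ∼-sym = reverse commStep-sym

  ∼-∙ˡ : {t t' : Term V} (s : Term V) → t ∼ t' → t ∙ s ∼ t' ∙ s
  ∼-∙ˡ s = gmap (_∙ s) (left s)

  ∼-∙ʳ : (t : Term V) {s s' : Term V} → s ∼ s' → t ∙ s ∼ t ∙ s'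
  ∼-∙ʳ t = gmap (t ∙_) (right t)

  occurs? : DecidableEquality V → (v : V) (u : Term V) → Dec (Occurs v u)
  occurs? _≟_ v (var w) with v ≟ w
  ... | yes refl = yes here
  ... | no v≢w   = no λ { here → v≢w refl }
  occurs? _≟_ v (u ∙ s) =
    map′ [ left s , right u ] (λ { (left _ o) → inj₁ o ; (right _ o) → inj₂ o })
         (occurs? _≟_ v u ⊎-dec occurs? _≟_ v s)

module FreeSteinerQuasigroup {V : Set} {_<V_ : Rel V 0ℓ} (compareV : Trichotomous _≡_ _<V_) where

  infix 4 _<_
  data _<_ : Rel (Term V) 0ℓ where
    var<var : ∀ {i j} → i <V j → var i < var j
    var<∙   : ∀ {i t s} → var i < t ∙ s
    ∙<∙ˡ    : ∀ {t₁ t₂ s₁ s₂} → t₁ < s₁ → t₁ ∙ t₂ < s₁ ∙ s₂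
    ∙<∙ʳ    : ∀ {t t₂ s₂} → t₂ < s₂ → t ∙ t₂ < t ∙ s₂

  compare : Trichotomous _≡_ _<_
  compare (var i) (var j) with compareV i j
  ... | tri< i<j i≢j i≯j =
        tri< (var<var i<j) (λ { refl → i≢j refl }) (λ { (var<var j<i) → i≯j j<i })
  ... | tri≈ i≮i refl _ =
        tri≈ (λ { (var<var i<i) → i≮i i<i }) refl (λ { (var<var i<i) → i≮i i<i })
  ... | tri> i≮j i≢j j<i =
        tri> (λ { (var<var i<j) → i≮j i<j }) (λ { refl → i≢j refl }) (var<var j<i)
  compare (var i) (s₁ ∙ s₂) = tri< var<∙ (λ ()) (λ ())
  compare (t₁ ∙ t₂) (var j) = tri> (λ ()) (λ ()) var<∙
  compare (t₁ ∙ t₂) (s₁ ∙ s₂) with compare t₁ s₁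
  ... | tri< t₁<s₁ t₁≢s₁ t₁≯s₁ =
        tri< (∙<∙ˡ t₁<s₁) (λ { refl → t₁≢s₁ refl })
             (λ { (∙<∙ˡ s₁<t₁) → t₁≯s₁ s₁<t₁ ; (∙<∙ʳ _) → t₁≢s₁ refl })
  ... | tri> t₁≮s₁ t₁≢s₁ s₁<t₁ =
        tri> (λ { (∙<∙ˡ t₁<s₁) → t₁≮s₁ t₁<s₁ ; (∙<∙ʳ _) → t₁≢s₁ refl })
             (λ { refl → t₁≢s₁ refl }) (∙<∙ˡ s₁<t₁)
  ... | tri≈ t₁≮t₁ refl _ with compare t₂ s₂
  ...   | tri< t₂<s₂ t₂≢s₂ t₂≯s₂ =
          tri< (∙<∙ʳ t₂<s₂) (λ { refl → t₂≢s₂ refl })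
               (λ { (∙<∙ˡ t₁<t₁) → t₁≮t₁ t₁<t₁ ; (∙<∙ʳ s₂<t₂) → t₂≯s₂ s₂<t₂ })
  ...   | tri≈ t₂≮t₂ refl _ =
          tri≈ t≮t refl t≮t
    where
    t≮t : ¬ (t₁ ∙ t₂ < t₁ ∙ t₂)
    t≮t (∙<∙ˡ t₁<t₁) = t₁≮t₁ t₁<t₁
    t≮t (∙<∙ʳ t₂<t₂) = t₂≮t₂ t₂<t₂
  ...   | tri> t₂≮s₂ t₂≢s₂ s₂<t₂ =
          tri> (λ { (∙<∙ˡ t₁<t₁) → t₁≮t₁ t₁<t₁ ; (∙<∙ʳ t₂<s₂) → t₂≮s₂ t₂<s₂ })
               (λ { refl → t₂≢s₂ refl }) (∙<∙ʳ s₂<t₂)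

  _≟_ : DecidableEquality (Term V)
  _≟_ = tri⇒dec≈ compare

  <⇒≢ : ∀ {t s} → t < s → t ≢ s
  <⇒≢ t<s t≡s = tri⇒irr compare t≡s t<s

  ordered : Term V → Term V → Term V
  ordered t s with compare t s
  ... | tri< _ _ _ = t ∙ s
  ... | tri≈ _ _ _ = t ∙ s
  ... | tri> _ _ _ = s ∙ t

  ordered-comm : ∀ t s → ordered t s ≡ ordered s t
  ordered-comm t s with compare t s | compare s t
  ... | tri< _ _ _     | tri> _ _ _     = refl
  ... | tri< _ _ t≯s   | tri< s<t _ _   = ⊥-elim (t≯s s<t)
  ... | tri< _ t≢s _   | tri≈ _ s≡t _   = ⊥-elim (t≢s (sym s≡t))
  ... | tri≈ _ refl _  | tri< _ _ _     = refl
  ... | tri≈ _ refl _  | tri≈ _ _ _     = refl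
  ... | tri≈ _ refl _  | tri> _ _ _     = refl
  ... | tri> _ _ _     | tri< _ _ _     = refl
  ... | tri> _ t≢s _   | tri≈ _ s≡t _   = ⊥-elim (t≢s (sym s≡t))
  ... | tri> t≮s _ _   | tri> _ _ t<s   = ⊥-elim (t≮s t<s)

  ordered-< : ∀ {t s} → t < s → ordered t s ≡ t ∙ s
  ordered-< {t} {s} t<s with compare t s
  ... | tri< _ _ _   = refl
  ... | tri≈ _ _ _   = refl
  ... | tri> t≮s _ _ = ⊥-elim (t≮s t<s)

  NotChild : Term V → Term V → Set
  NotChild t (var _)   = ⊤
  NotChild t (s₁ ∙ s₂) = t ≢ s₁ × t ≢ s₂

  notChild? : ∀ t s → Dec (NotChild t s)
  notChild? t (var _)   = yes tt
  notChild? t (s₁ ∙ s₂) = ¬? (t ≟ s₁) ×-dec ¬? (t ≟ s₂)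

  notChild-ordered : ∀ {t s₁ s₂} → t ≢ s₁ → t ≢ s₂ → NotChild t (ordered s₁ s₂)
  notChild-ordered {t} {s₁} {s₂} t≢s₁ t≢s₂ with compare s₁ s₂
  ... | tri< _ _ _ = t≢s₁ , t≢s₂
  ... | tri≈ _ _ _ = t≢s₁ , t≢s₂
  ... | tri> _ _ _ = t≢s₂ , t≢s₁

  Apart : Term V → Term V → Set
  Apart t s = t ≢ s × NotChild t s × NotChild s t

  -- Reduced terms with ordered products. On these ∼ is equality (canonical-∼⇒≡),
  -- which is why NotChild can use ≢ where Reduced uses ≁.
  Canonical : Term V → Set
  Canonical (var _) = ⊤
  Canonical (t ∙ s) = Canonical t × Canonical s × t < s × NotChild t s × NotChild s t

  canonical? : ∀ t → Dec (Canonical t)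
  canonical? (var _) = yes tt
  canonical? (t ∙ s) =
    canonical? t ×-dec canonical? s ×-dec tri⇒dec< compare t s ×-dec notChild? t s ×-dec notChild? s t

  canonical-ordered : ∀ {t s} → Canonical t → Canonical s → Apart t s → Canonical (ordered t s)
  canonical-ordered {t} {s} ct cs (t≢s , t∉s , s∉t) with compare t s
  ... | tri< t<s _ _ = ct , cs , t<s , t∉s , s∉t
  ... | tri≈ _ t≡s _ = ⊥-elim (t≢s t≡s)
  ... | tri> _ _ s<t = cs , ct , s<t , s∉t , t∉s

  data Shape : Term V → Term V → Set where
    same  : ∀ {t} → Shape t t
    ∈ˡ    : ∀ {t} u → Shape t (t ∙ u)
    ∈ʳ    : ∀ {t} u → Shape t (u ∙ t)
    ∋ˡ    : ∀ {s} u → Shape (s ∙ u) s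
    ∋ʳ    : ∀ {s} u → Shape (u ∙ s) s
    apart : ∀ {t s} → Apart t s → Shape t s

  swap : ∀ {t s} → Shape t s → Shape s t
  swap same                      = same
  swap (∈ˡ u)                    = ∋ˡ u
  swap (∈ʳ u)                    = ∋ʳ u
  swap (∋ˡ u)                    = ∈ˡ u
  swap (∋ʳ u)                    = ∈ʳ u
  swap (apart (t≢s , t∉s , s∉t)) = apart (t≢s ∘ sym , s∉t , t∉s)

  childShape : ∀ {t s} → ¬ NotChild t s → Shape t s
  childShape {t} {var _}   ¬t∉s = ⊥-elim (¬t∉s tt)
  childShape {t} {s₁ ∙ s₂} ¬t∉s with t ≟ s₁ | t ≟ s₂
  ... | yes refl | _        = ∈ˡ s₂
  ... | no _     | yes refl = ∈ʳ s₁
  ... | no t≢s₁  | no t≢s₂  = ⊥-elim (¬t∉s (t≢s₁ , t≢s₂))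

  shape : ∀ t s → Shape t s
  shape t s with t ≟ s | notChild? t s | notChild? s t
  ... | yes refl | _       | _        = same
  ... | no t≢s   | yes t∉s | yes s∉t  = apart (t≢s , t∉s , s∉t)
  ... | no _     | no ¬t∉s | _        = childShape ¬t∉s
  ... | no _     | yes _   | no ¬s∉t  = swap (childShape ¬s∉t)

  product : ∀ {t s} → Shape t s → Term V
  product {t} same            = t
  product (∈ˡ u)              = u
  product (∈ʳ u)              = u
  product (∋ˡ u)              = u
  product (∋ʳ u)              = u
  product {t} {s} (apart _)   = ordered t s

  product-apart : ∀ {t s} (sh : Shape t s) → Apart t s → product sh ≡ ordered t s
  product-apart same      (t≢t , _ , _)       = ⊥-elim (t≢t refl)
  product-apart (∈ˡ _)    (_ , (t≢t , _) , _) = ⊥-elim (t≢t refl)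
  product-apart (∈ʳ _)    (_ , (_ , t≢t) , _) = ⊥-elim (t≢t refl)
  product-apart (∋ˡ _)    (_ , _ , (s≢s , _)) = ⊥-elim (s≢s refl)
  product-apart (∋ʳ _)    (_ , _ , (_ , s≢s)) = ⊥-elim (s≢s refl)
  product-apart (apart _) _                   = refl

  -- A pair may have several shapes (t and t ∙ t have both ∈ˡ t and ∈ʳ t), but one product.
  product-unique : ∀ {t s} (sh sh' : Shape t s) → product sh ≡ product sh'
  product-unique same    same               = refl
  product-unique (∈ˡ _)  (∈ˡ _)             = refl
  product-unique (∈ˡ _)  (∈ʳ _)             = refl
  product-unique (∈ʳ _)  (∈ˡ _)             = refl
  product-unique (∈ʳ _)  (∈ʳ _)             = refl
  product-unique (∋ˡ _)  (∋ˡ _)             = refl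
  product-unique (∋ˡ _)  (∋ʳ _)             = refl
  product-unique (∋ʳ _)  (∋ˡ _)             = refl
  product-unique (∋ʳ _)  (∋ʳ _)             = refl
  product-unique sh      (apart t⊥s)        = product-apart sh t⊥s
  product-unique (apart t⊥s) sh             = sym (product-apart sh t⊥s)

  product-swap : ∀ {t s} (sh : Shape t s) → product (swap sh) ≡ product sh
  product-swap same      = refl
  product-swap (∈ˡ _)    = refl
  product-swap (∈ʳ _)    = refl
  product-swap (∋ˡ _)    = refl
  product-swap (∋ʳ _)    = refl
  product-swap {t} {s} (apart _) = ordered-comm s t

  infixl 7 _⊙_
  _⊙_ : Term V → Term V → Term V
  t ⊙ s = product (shape t s)

  ⊙-shape : ∀ {t s} (sh : Shape t s) → t ⊙ s ≡ product sh
  ⊙-shape {t} {s} = product-unique (shape t s)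

  ⊙-idem : ∀ t → t ⊙ t ≡ t
  ⊙-idem t = ⊙-shape same

  ⊙-comm : ∀ t s → t ⊙ s ≡ s ⊙ t
  ⊙-comm t s = trans (sym (product-swap (shape t s))) (sym (⊙-shape (swap (shape t s))))

  ⊙-canonical-∙ : ∀ {t s} → Canonical (t ∙ s) → t ⊙ s ≡ t ∙ s
  ⊙-canonical-∙ (_ , _ , t<s , t∉s , s∉t) =
    trans (⊙-shape (apart (<⇒≢ t<s , t∉s , s∉t))) (ordered-< t<s)

  ⊙-ordered : ∀ t s → t ⊙ ordered t s ≡ s
  ⊙-ordered t s with compare t s
  ... | tri< _ _ _ = ⊙-shape (∈ˡ {t} s)
  ... | tri≈ _ _ _ = ⊙-shape (∈ˡ {t} s)
  ... | tri> _ _ _ = ⊙-shape (∈ʳ {t} s)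

  ⊙-product : ∀ {t s} → Canonical s → (sh : Shape t s) → t ⊙ product sh ≡ s
  ⊙-product _  same             = ⊙-idem _
  ⊙-product cs (∈ˡ _)           = ⊙-canonical-∙ cs
  ⊙-product cs (∈ʳ u)           = trans (⊙-comm _ u) (⊙-canonical-∙ cs)
  ⊙-product _  (∋ˡ {s} u)       = ⊙-shape (∋ʳ {u} s)
  ⊙-product _  (∋ʳ {s} u)       = ⊙-shape (∋ˡ {u} s)
  ⊙-product {t} {s} _ (apart _) = ⊙-ordered t s

  ⊙-absorb : ∀ t {s} → Canonical s → t ⊙ (t ⊙ s) ≡ s
  ⊙-absorb t {s} cs = ⊙-product cs (shape t s)

  canonical-product : ∀ {t s} → Canonical t → Canonical s →
                      (sh : Shape t s) → Canonical (product sh)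
  canonical-product ct _              same      = ct
  canonical-product _  (_ , cu , _)   (∈ˡ _)    = cu
  canonical-product _  (cu , _)       (∈ʳ _)    = cu
  canonical-product (_ , cu , _) _    (∋ˡ _)    = cu
  canonical-product (cu , _) _        (∋ʳ _)    = cu
  canonical-product ct cs             (apart a) = canonical-ordered ct cs a

  canonical-⊙ : ∀ {t s} → Canonical t → Canonical s → Canonical (t ⊙ s)
  canonical-⊙ {t} {s} ct cs = canonical-product ct cs (shape t s)

  -- Canonicity is carried as a boolean proof so that the carrier has
  -- propositional equality determined by the underlying term.
  CanonicalTerm : Set
  CanonicalTerm = Σ (Term V) (λ t → True (canonical? t))

  canonical : (x : CanonicalTerm) → Canonical (proj₁ x)
  canonical (_ , c) = toWitness c

  canonicalTerm-≡ : {x y : CanonicalTerm} → proj₁ x ≡ proj₁ y → x ≡ y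
  canonicalTerm-≡ {t , c} {.t , c'} refl = cong (t ,_) (T-irrelevant c c')

  free : SteinerQuasigroup
  free = record
    { Carrier = CanonicalTerm
    ; _·_     = λ x y → proj₁ x ⊙ proj₁ y , fromWitness (canonical-⊙ (canonical x) (canonical y))
    ; comm    = λ x y → canonicalTerm-≡ (⊙-comm (proj₁ x) (proj₁ y))
    ; idem    = λ x → canonicalTerm-≡ (⊙-idem (proj₁ x))
    ; absorb  = λ x y → canonicalTerm-≡ (⊙-absorb (proj₁ x) (canonical y))
    }

  normalize : Term V → Term V
  normalize (var i) = var i
  normalize (t ∙ s) = ordered (normalize t) (normalize s)

  ∼-ordered : ∀ t s → t ∙ s ∼ ordered t s
  ∼-ordered t s with compare t s
  ... | tri< _ _ _ = ε
  ... | tri≈ _ _ _ = ε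
  ... | tri> _ _ _ = here t s ◅ ε

  ∼-normalize : ∀ t → t ∼ normalize t
  ∼-normalize (var i) = ε
  ∼-normalize (t ∙ s) =
    ∼-∙ˡ s (∼-normalize t) ◅◅ ∼-∙ʳ (normalize t) (∼-normalize s)
      ◅◅ ∼-ordered (normalize t) (normalize s)

  normalize-commStep : ∀ {t s} → CommStep t s → normalize t ≡ normalize s
  normalize-commStep (here t s)   = ordered-comm (normalize t) (normalize s)
  normalize-commStep (left s st)  = cong (λ u → ordered u (normalize s)) (normalize-commStep st)
  normalize-commStep (right t st) = cong (ordered (normalize t)) (normalize-commStep st)

  ∼⇒normalize≡ : ∀ {t s} → t ∼ s → normalize t ≡ normalize s
  ∼⇒normalize≡ ε         = refl
  ∼⇒normalize≡ (st ◅ ss) = trans (normalize-commStep st) (∼⇒normalize≡ ss)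

  normalize≡⇒∼ : ∀ {t s} → normalize t ≡ normalize s → t ∼ s
  normalize≡⇒∼ {t} {s} eq = ∼-normalize t ◅◅ subst (_∼ s) (sym eq) (∼-sym (∼-normalize s))

  normalize-canonical : ∀ {t} → Canonical t → normalize t ≡ t
  normalize-canonical {var _} _ = refl
  normalize-canonical {t ∙ s} (ct , cs , t<s , _)
    rewrite normalize-canonical ct | normalize-canonical cs = ordered-< t<s

  canonical-∼⇒≡ : ∀ {t s} → Canonical t → Canonical s → t ∼ s → t ≡ s
  canonical-∼⇒≡ {t} {s} ct cs t∼s = begin
    t            ≡⟨ sym (normalize-canonical ct) ⟩
    normalize t  ≡⟨ ∼⇒normalize≡ t∼s ⟩
    normalize s  ≡⟨ normalize-canonical cs ⟩
    s            ∎
    where open ≡-Reasoning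

  canonical⇒reduced : ∀ {t} → Canonical t → Reduced t
  canonical⇒reduced {var _} _ = tt
  canonical⇒reduced {t ∙ s} (ct , cs , t<s , t∉s , s∉t) =
    canonical⇒reduced ct , canonical⇒reduced cs , <⇒≢ t<s ∘ canonical-∼⇒≡ ct cs ,
    rightOK s cs t∉s , leftOK t ct s∉t
    where
    rightOK : ∀ s → Canonical s → NotChild t s → RightOK t s
    rightOK (var _)   _                  _             = tt
    rightOK (s₁ ∙ s₂) (cs₁ , cs₂ , _)    (t≢s₁ , t≢s₂) =
      t≢s₁ ∘ canonical-∼⇒≡ ct cs₁ , t≢s₂ ∘ canonical-∼⇒≡ ct cs₂
    leftOK : ∀ t → Canonical t → NotChild s t → LeftOK t s
    leftOK (var _)   _                  _             = tt
    leftOK (t₁ ∙ t₂) (ct₁ , ct₂ , _)    (s≢t₁ , s≢t₂) =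
      s≢t₁ ∘ sym ∘ canonical-∼⇒≡ ct₁ cs , s≢t₂ ∘ sym ∘ canonical-∼⇒≡ ct₂ cs

  reduced⇒canonical-normalize : ∀ {t} → Reduced t → Canonical (normalize t)
  reduced⇒canonical-normalize {var _} _ = tt
  reduced⇒canonical-normalize {t ∙ s} (rt , rs , t≁s , rightOK , leftOK) =
    canonical-ordered (reduced⇒canonical-normalize rt) (reduced⇒canonical-normalize rs)
      (t≁s ∘ normalize≡⇒∼ , notChild-right s rightOK , notChild-left t leftOK)
    where
    notChild-right : ∀ s → RightOK t s → NotChild (normalize t) (normalize s)
    notChild-right (var _)   _             = tt
    notChild-right (s₁ ∙ s₂) (t≁s₁ , t≁s₂) =
      notChild-ordered (t≁s₁ ∘ normalize≡⇒∼) (t≁s₂ ∘ normalize≡⇒∼)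
    notChild-left : ∀ t → LeftOK t s → NotChild (normalize s) (normalize t)
    notChild-left (var _)   _             = tt
    notChild-left (t₁ ∙ t₂) (t₁≁s , t₂≁s) =
      notChild-ordered (t₁≁s ∘ normalize≡⇒∼ ∘ sym) (t₂≁s ∘ normalize≡⇒∼ ∘ sym)

  module _ (M : SteinerQuasigroup) (ρ : V → SteinerQuasigroup.Carrier M) where
    open SteinerQuasigroup M
    open SteinerQuasigroupProperties M

    eval-ordered : ∀ t s → eval M ρ (ordered t s) ≡ eval M ρ t · eval M ρ s
    eval-ordered t s with compare t s
    ... | tri< _ _ _ = refl
    ... | tri≈ _ _ _ = refl
    ... | tri> _ _ _ = comm (eval M ρ s) (eval M ρ t)

    eval-product : ∀ {t s} (sh : Shape t s) → eval M ρ (product sh) ≡ eval M ρ t · eval M ρ s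
    eval-product {t} same        = sym (idem (eval M ρ t))
    eval-product {t} (∈ˡ u)      = sym (absorb (eval M ρ t) (eval M ρ u))
    eval-product {t} (∈ʳ u)      = sym (x·[y·x]≡y (eval M ρ t) (eval M ρ u))
    eval-product {_} {s} (∋ˡ u)  = sym ([x·y]·x≡y (eval M ρ s) (eval M ρ u))
    eval-product {_} {s} (∋ʳ u)  = sym ([y·x]·x≡y (eval M ρ s) (eval M ρ u))
    eval-product {t} {s} (apart _) = eval-ordered t s

    eval-⊙ : ∀ t s → eval M ρ (t ⊙ s) ≡ eval M ρ t · eval M ρ s
    eval-⊙ t s = eval-product (shape t s)

    eval-normalize : ∀ t → eval M ρ (normalize t) ≡ eval M ρ t
    eval-normalize (var _) = refl
    eval-normalize (t ∙ s) =
      trans (eval-ordered (normalize t) (normalize s)) (cong₂ _·_ (eval-normalize t) (eval-normalize s))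

code : ∀ {n} → Var n → ℕ
code (inj₁ i) = suc (toℕ i)
code (inj₂ _) = zero

code-injective : ∀ {n} {v w : Var n} → code v ≡ code w → v ≡ w
code-injective {v = inj₁ _} {inj₁ _} eq = cong inj₁ (toℕ-injective (suc-injective eq))
code-injective {v = inj₂ _} {inj₂ _} _  = refl

compareVar : ∀ {n} → Trichotomous _≡_ (ℕ._<_ on code {n})
compareVar v w with <-cmp (code v) (code w)
... | tri< v<w v≢w v≯w = tri< v<w (v≢w ∘ cong code) v≯w
... | tri≈ v≮w v≡w v≯w = tri≈ v≮w (code-injective v≡w) v≯w
... | tri> v≮w v≢w w<v = tri> v≮w (v≢w ∘ cong code) w<v

reduced≡yvar : (t : Term (Var 0)) → Reduced t → t ≡ var yvar
reduced≡yvar (var (inj₂ _)) _ = refl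
reduced≡yvar (t ∙ s) (rt , rs , t≁s , _) with reduced≡yvar t rt | reduced≡yvar s rs
... | refl | refl = ⊥-elim (t≁s ε)

module _ (M : SteinerQuasigroup) {n : ℕ} (a : Fin n → SteinerQuasigroup.Carrier M)
         (b : SteinerQuasigroup.Carrier M) where
  open SteinerQuasigroup M
  open SteinerQuasigroupProperties M
  open FreeSteinerQuasigroup (compareVar {n})
  open SteinerQuasigroup free using () renaming (_·_ to _⋆_)
  module Free = SteinerQuasigroupProperties free
  open ≡-Reasoning

  ⟦_⟧ : Term (Var n) → Carrier
  ⟦_⟧ = eval M (a ,, b)

  y∉⇒generated : ∀ u → ¬ Occurs yvar u → InGen M a ⟦ u ⟧
  y∉⇒generated (var (inj₁ i)) _   = var i , refl
  y∉⇒generated (var (inj₂ _)) y∉u = ⊥-elim (y∉u here)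
  y∉⇒generated (u ∙ s) y∉us
    with y∉⇒generated u (y∉us ∘ left s) | y∉⇒generated s (y∉us ∘ right u)
  ... | u' , u'≡u | s' , s'≡s = u' ∙ s' , cong₂ _·_ u'≡u s'≡s

  hom-eval-id : (h : (c : Carrier) → InGen M a c → CanonicalTerm) →
                (∀ i p → h (a i) p ≡ (var (inj₁ i) , tt)) →
                (∀ c d p q r → h (c · d) r ≡ h c p ⋆ h d q) →
                ∀ {u} → Canonical u → (y∉u : ¬ Occurs yvar u) →
                ∀ p → proj₁ (h ⟦ u ⟧ p) ≡ u
  hom-eval-id h h-gen h-hom {var (inj₁ i)} _ _ p = cong proj₁ (h-gen i p)
  hom-eval-id h h-gen h-hom {var (inj₂ _)} _ y∉u _ = ⊥-elim (y∉u here)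
  hom-eval-id h h-gen h-hom {u ∙ s} cus@(cu , cs , _) y∉us p = begin
    proj₁ (h ⟦ u ∙ s ⟧ p)                    ≡⟨ cong proj₁ (h-hom _ _ gen-u gen-s p) ⟩
    proj₁ (h ⟦ u ⟧ gen-u) ⊙ proj₁ (h ⟦ s ⟧ gen-s)
      ≡⟨ cong₂ _⊙_ (hom-eval-id h h-gen h-hom cu y∉u gen-u) (hom-eval-id h h-gen h-hom cs y∉s gen-s) ⟩
    u ⊙ s                                    ≡⟨ ⊙-canonical-∙ cus ⟩
    u ∙ s                                    ∎
    where
    y∉u : ¬ Occurs yvar u
    y∉u = y∉us ∘ left s
    y∉s : ¬ Occurs yvar s
    y∉s = y∉us ∘ right u
    gen-u : InGen M a ⟦ u ⟧
    gen-u = y∉⇒generated u y∉u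
    gen-s : InGen M a ⟦ s ⟧
    gen-s = y∉⇒generated s y∉s

  eval-injective : FreelyGenerated M a → ∀ {u s} → Canonical u → Canonical s →
                   ¬ Occurs yvar u → ¬ Occurs yvar s → ⟦ u ⟧ ≡ ⟦ s ⟧ → u ≡ s
  eval-injective freely {u} {s} cu cs y∉u y∉s eq
    with freely free (λ i → var (inj₁ i) , tt)
  ... | h , h-irr , h-gen , h-hom = begin
    u                        ≡⟨ sym (hom-eval-id h h-gen h-hom cu y∉u gen-u) ⟩
    proj₁ (h ⟦ u ⟧ gen-u)    ≡⟨ cong proj₁ (h-resp eq gen-u gen-s) ⟩
    proj₁ (h ⟦ s ⟧ gen-s)    ≡⟨ hom-eval-id h h-gen h-hom cs y∉s gen-s ⟩
    s                        ∎
    where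
    gen-u : InGen M a ⟦ u ⟧
    gen-u = y∉⇒generated u y∉u
    gen-s : InGen M a ⟦ s ⟧
    gen-s = y∉⇒generated s y∉s
    h-resp : ∀ {c d} → c ≡ d → ∀ p q → h c p ≡ h d q
    h-resp refl = h-irr _

  collision⇒y-term-for-generator :
    FreelyGenerated M a → (i : Fin n) → {p q : CanonicalTerm} →
    p ≢ q → ⟦ proj₁ p ⟧ ≡ ⟦ proj₁ q ⟧ →
    Σ CanonicalTerm λ q' → ⟦ proj₁ q' ⟧ ≡ a i × Occurs yvar (proj₁ q')
  collision⇒y-term-for-generator freely i {p} {q} p≢q ⟦p⟧≡⟦q⟧ =
    q' , ⟦q'⟧≡aᵢ , decidable-stable (occurs? (tri⇒dec≈ compareVar) yvar (proj₁ q')) ¬y∉q'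
    where
    x w q' : CanonicalTerm
    x  = var (inj₁ i) , tt
    w  = p ⋆ x
    q' = w ⋆ q

    ⟦q'⟧≡aᵢ : ⟦ proj₁ q' ⟧ ≡ a i
    ⟦q'⟧≡aᵢ = begin
      ⟦ proj₁ q' ⟧                       ≡⟨ eval-⊙ M (a ,, b) (proj₁ w) (proj₁ q) ⟩
      ⟦ proj₁ w ⟧ · ⟦ proj₁ q ⟧
        ≡⟨ cong₂ _·_ (eval-⊙ M (a ,, b) (proj₁ p) (proj₁ x)) (sym ⟦p⟧≡⟦q⟧) ⟩
      (⟦ proj₁ p ⟧ · a i) · ⟦ proj₁ p ⟧  ≡⟨ [x·y]·x≡y ⟦ proj₁ p ⟧ (a i) ⟩
      a i                                ∎

    ¬y∉q' : ¬ ¬ Occurs yvar (proj₁ q')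
    ¬y∉q' y∉q' = p≢q (Free.·-cancelˡ w (trans (Free.[x·y]·x≡y p x) (sym q'≡x)))
      where
      q'≡x : q' ≡ x
      q'≡x = canonicalTerm-≡ (eval-injective freely (canonical q') tt y∉q' (λ ()) ⟦q'⟧≡aᵢ)

lemma5p6 : (M : SteinerQuasigroup) {n : ℕ}
    (a : Fin n → SteinerQuasigroup.Carrier M) (b : SteinerQuasigroup.Carrier M) →
    Independent M a →
    (t r : Term (Var n)) → Reduced t → Reduced r →
    eval M (a ,, b) t ≡ eval M (a ,, b) r → ¬ (t ∼ r) →
    Σ (Term (Var n)) λ t' →
      Reduced t' × InGen M a (eval M (a ,, b) t') × Occurs yvar t'
lemma5p6 M {zero} a b _ t r rt rr _ t≁r with reduced≡yvar t rt | reduced≡yvar r rr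
... | refl | refl = ⊥-elim (t≁r ε)
lemma5p6 M {suc n} a b (_ , freely) t r rt rr t≈r t≁r =
  let q' , ⟦q'⟧≡a₀ , y∈q' =
        collision⇒y-term-for-generator M a b freely Fin.zero p≢q ⟦p⟧≡⟦q⟧
  in proj₁ q' , canonical⇒reduced (canonical q') , (var Fin.zero , sym ⟦q'⟧≡a₀) , y∈q'
  where
  open FreeSteinerQuasigroup (compareVar {suc n})

  p q : CanonicalTerm
  p = normalize t , fromWitness (reduced⇒canonical-normalize rt)
  q = normalize r , fromWitness (reduced⇒canonical-normalize rr)

  p≢q : p ≢ q
  p≢q = t≁r ∘ normalize≡⇒∼ ∘ cong proj₁

  ⟦p⟧≡⟦q⟧ : eval M (a ,, b) (normalize t) ≡ eval M (a ,, b) (normalize r)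
  ⟦p⟧≡⟦q⟧ = trans (eval-normalize M (a ,, b) t) (trans t≈r (sym (eval-normalize M (a ,, b) r)))
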